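{- Let $P$ be a finite poset and let $f:P\to B_m$ be an embedding. Then the elements of $B_m$ can be labeled bijectively with the numbers $1,2,\dots,2^m$ such that every set receives a higher number than each of its proper subsets, and the numbers assigned to the elements of $\mathrm{conv}(\mathrm{Im}(f))$ form an interval of consecutive integers in $[1,2^m]$.
   Context: $B_m$ denotes the poset of all subsets of $[m]$ ordered by inclusion. For a finite poset $(P,<_p)$, an embedding $f:P\to B_m$ is an injective map with $f(a)\subset f(b)$ whenever $a<_p b$. For $F\subseteq B_m$, the convex hull is $\mathrm{conv}(F)=\{b\in B_m:\exists a,c\in F,\ a\subseteq b\subseteq c\}$. -}

module Defs where

open import Data.Nat using (ℕ; _^_; _≤_; _<_)
open import Data.Fin using (Fin; toℕ)
open import Data.Fin.Subset using (Subset; _⊆_; _⊂_)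
open import Data.Product using (Σ; _×_; ∃₂)
open import Relation.Binary.PropositionalEquality using (_≡_)
open import Relation.Binary.Structures using (IsStrictPartialOrder)
open import Function.Definitions using (Injective)
open import Function.Bundles using (_⤖_; _⇔_; Bijection)

B : ℕ → Set
B m = Subset m

record FinPoset : Set₁ where
  field
    size  : ℕ
    _<p_  : Fin size → Fin size → Set
    isSPO : IsStrictPartialOrder _≡_ _<p_

open FinPoset public

record IsEmbedding (P : FinPoset) (m : ℕ) (f : Fin (size P) → B m) : Set where
  field
    injective : Injective _≡_ _≡_ f
    monotone  : ∀ {a b} → _<p_ P a b → f a ⊂ f b

conv : ∀ {I : Set} {m : ℕ} → (I → B m) → B m → Set
conv {I} F b = ∃₂ λ (a c : I) → (F a ⊆ b) × (b ⊆ F c)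

-- A labeling of B_m bijectively by Fin (2^m) (label ℓ stands for the
-- number toℕ ℓ + 1 ∈ [1, 2^m]) in which every set receives a higher
-- number than each of its proper subsets.
IsLinearLabeling : (m : ℕ) → (B m ⤖ Fin (2 ^ m)) → Set
IsLinearLabeling m L = ∀ {x y : B m} → x ⊂ y →
  toℕ (Bijection.to L x) < toℕ (Bijection.to L y)

LabelsFormInterval : (m : ℕ) → (B m ⤖ Fin (2 ^ m)) → (B m → Set) → Set
LabelsFormInterval m L S = Σ ℕ λ lo → Σ ℕ λ hi → ∀ (x : B m) →
  S x ⇔ ((lo ≤ toℕ (Bijection.to L x)) × (toℕ (Bijection.to L x) < hi))

-- Order B_m first by a level that is 0 below some f c but above no f a, 1 on the hull, and at
-- least 2 below no f c, breaking ties by the binary value of the subset (the key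
-- 2 ^ m * level + value). Being below some f c is inherited by subsets and being above some f a
-- by supersets, so the level is monotone for ⊆, while the binary value is strictly monotone for
-- ⊂. Labelling each set by the number of sets of smaller key therefore respects ⊂, and the hull,
-- being exactly the level-1 class, receives a block of consecutive labels.
module Submission where

open import Defs
open import Data.Bool using (false; true)
open import Data.Fin using (Fin; zero; toℕ; fromℕ<; combine; remQuot; punchOut)
open import Data.Fin.Properties
  using (2↔Bool; any?; toℕ<n; toℕ-combine; combine-injective; combine-remQuot; toℕ-fromℕ<;
         fromℕ<-injective; toℕ-injective; injective⇒≤; punchOut-injective)
  renaming (_≟_ to _≟ᶠ_)
open import Data.Fin.Subset using (Subset; _⊆_; _⊂_; outside; inside)
open import Data.Fin.Subset.Properties using (_⊆?_; drop-∷-⊆; ⊆-trans; ⊂-irref)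
open import Data.Nat using (ℕ; zero; suc; _+_; _*_; _^_; _≤_; _<_; z≤n; s≤s; s≤s⁻¹; _<?_)
open import Data.Nat.Properties
open import Data.Product using (Σ; _×_; _,_; proj₁; proj₂; ∃)
open import Data.Product.Function.NonDependent.Propositional using (_×-⇔_)
open import Data.Unit using (tt)
open import Data.Vec using ([]; _∷_; here)
open import Function using (_∘_)
open import Function.Bundles using (_⤖_; _⇔_; mk⤖; mk⇔; Inverse; Equivalence)
open import Function.Consequences.Propositional using (strictlySurjective⇒surjective)
open import Function.Construct.Composition using (_⇔-∘_)
open import Function.Definitions using (Injective; StrictlySurjective)
open import Level using (Level)
open import Relation.Binary.Definitions using (tri<; tri≈; tri>)
open import Relation.Binary.PropositionalEquality
  using (_≡_; _≢_; refl; sym; trans; cong; cong₂; subst; module ≡-Reasoning)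
open import Relation.Nullary using (Dec; yes; no; ¬_; ¬?; contradiction)
open import Relation.Unary using (Pred; Decidable)
open import Relation.Unary.Properties using (U?)

private
  variable
    ℓ ℓ′ : Level
    X Y : Set ℓ
    m : ℕ

indicator : Dec X → ℕ
indicator (yes _) = 1
indicator (no _)  = 0

indicator-mono : (a : Dec X) (b : Dec Y) → (X → Y) → indicator a ≤ indicator b
indicator-mono (yes _) (yes _) _   = ≤-refl
indicator-mono (yes a) (no ¬b) a→b = contradiction (a→b a) ¬b
indicator-mono (no _)  _       _   = z≤n

indicator-mono-< : (a : Dec X) (b : Dec Y) → Y → ¬ X → indicator a < indicator b
indicator-mono-< (yes a) _       _ ¬a = contradiction a ¬a
indicator-mono-< (no _)  (yes _) _ _  = s≤s z≤n
indicator-mono-< (no _)  (no ¬b) b _  = contradiction b ¬b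

count : {P : Pred (Subset m) ℓ} → Decidable P → ℕ
count {zero}  P? = indicator (P? [])
count {suc m} P? = count (P? ∘ (outside ∷_)) + count (P? ∘ (inside ∷_))

count-mono : {P : Pred (Subset m) ℓ} {Q : Pred (Subset m) ℓ′} →
             (P? : Decidable P) (Q? : Decidable Q) → (∀ x → P x → Q x) →
             count P? ≤ count Q?
count-mono {m = zero}  P? Q? P⇒Q = indicator-mono (P? []) (Q? []) (P⇒Q [])
count-mono {m = suc m} P? Q? P⇒Q =
  +-mono-≤ (count-mono (P? ∘ (outside ∷_)) (Q? ∘ (outside ∷_)) (P⇒Q ∘ (outside ∷_)))
           (count-mono (P? ∘ (inside ∷_))  (Q? ∘ (inside ∷_))  (P⇒Q ∘ (inside ∷_)))

count-mono-< : {P : Pred (Subset m) ℓ} {Q : Pred (Subset m) ℓ′} →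
               (P? : Decidable P) (Q? : Decidable Q) → (∀ x → P x → Q x) →
               ∀ w → Q w → ¬ P w → count P? < count Q?
count-mono-< {m = zero} P? Q? _ [] Qw ¬Pw = indicator-mono-< (P? []) (Q? []) Qw ¬Pw
count-mono-< {m = suc m} P? Q? P⇒Q (false ∷ w) Qw ¬Pw =
  +-mono-<-≤ (count-mono-< (P? ∘ (outside ∷_)) (Q? ∘ (outside ∷_)) (P⇒Q ∘ (outside ∷_)) w Qw ¬Pw)
             (count-mono (P? ∘ (inside ∷_)) (Q? ∘ (inside ∷_)) (P⇒Q ∘ (inside ∷_)))
count-mono-< {m = suc m} P? Q? P⇒Q (true ∷ w) Qw ¬Pw =
  +-mono-≤-< (count-mono (P? ∘ (outside ∷_)) (Q? ∘ (outside ∷_)) (P⇒Q ∘ (outside ∷_)))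
             (count-mono-< (P? ∘ (inside ∷_)) (Q? ∘ (inside ∷_)) (P⇒Q ∘ (inside ∷_)) w Qw ¬Pw)

count-U : ∀ m → count {m} U? ≡ 2 ^ m
count-U zero    = refl
count-U (suc m) = cong₂ _+_ (count-U m) (trans (count-U m) (sym (+-identityʳ _)))

open Inverse 2↔Bool using (strictlyInverseˡ; strictlyInverseʳ)
  renaming (to to Fin2→Bool; from to Bool→Fin2)

-- The first element of a subset is its most significant bit.
encode : Subset m → Fin (2 ^ m)
encode []      = zero
encode (b ∷ x) = combine (Bool→Fin2 b) (encode x)

decode : Fin (2 ^ m) → Subset m
decode {zero}  _ = []
decode {suc m} i = Fin2→Bool (proj₁ (remQuot {2} (2 ^ m) i)) ∷
                   decode (proj₂ (remQuot {2} (2 ^ m) i))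

encode∘decode : (i : Fin (2 ^ m)) → encode (decode {m} i) ≡ i
encode∘decode {zero}  zero = refl
encode∘decode {suc m} i    = begin
  combine (Bool→Fin2 (Fin2→Bool q)) (encode (decode {m} r))
    ≡⟨ cong₂ combine (strictlyInverseʳ q) (encode∘decode {m} r) ⟩
  combine q r
    ≡⟨ combine-remQuot {2} (2 ^ m) i ⟩
  i ∎
  where
  open ≡-Reasoning
  q = proj₁ (remQuot {2} (2 ^ m) i)
  r = proj₂ (remQuot {2} (2 ^ m) i)

decode-injective : Injective _≡_ _≡_ (decode {m})
decode-injective {m} {i} {j} e =
  trans (sym (encode∘decode {m} i)) (trans (cong encode e) (encode∘decode {m} j))

encode-injective : Injective _≡_ _≡_ (encode {m})
encode-injective {x = []}    {[]}    _ = refl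
encode-injective {x = a ∷ x} {b ∷ y} e with combine-injective _ _ _ _ e
... | a≡b , x≡y = cong₂ _∷_ (Bool→Fin2-injective a≡b) (encode-injective x≡y)
  where
  Bool→Fin2-injective : Bool→Fin2 a ≡ Bool→Fin2 b → a ≡ b
  Bool→Fin2-injective e′ =
    trans (sym (strictlyInverseˡ a)) (trans (cong Fin2→Bool e′) (strictlyInverseˡ b))

encode-mono-⊆ : {x y : Subset m} → x ⊆ y → toℕ (encode x) ≤ toℕ (encode y)
encode-mono-⊆ {x = []} {[]} _ = z≤n
encode-mono-⊆ {suc m} {a ∷ x} {b ∷ y} x⊆y rewrite toℕ-combine (Bool→Fin2 a) (encode x)
                                           | toℕ-combine (Bool→Fin2 b) (encode y) =
  +-mono-≤ (*-monoʳ-≤ (2 ^ m) (head-mono a b x⊆y)) (encode-mono-⊆ (drop-∷-⊆ x⊆y))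
  where
  head-mono : ∀ a b → (a ∷ x) ⊆ (b ∷ y) → toℕ (Bool→Fin2 a) ≤ toℕ (Bool→Fin2 b)
  head-mono false _     _     = z≤n
  head-mono true  true  _     = ≤-refl
  head-mono true  false ax⊆by with () ← ax⊆by here

encode-mono-⊂ : {x y : Subset m} → x ⊂ y → toℕ (encode x) < toℕ (encode y)
encode-mono-⊂ x⊂y = ≤∧≢⇒< (encode-mono-⊆ (proj₁ x⊂y))
  (λ e → ⊂-irref (encode-injective (toℕ-injective e)) x⊂y)

injective⇒strictlySurjective : ∀ {n} (h : Fin n → Fin n) → Injective _≡_ _≡_ h →
                               StrictlySurjective _≡_ h
injective⇒strictlySurjective {suc n} h h-injective k with any? (λ i → h i ≟ᶠ k)
... | yes hit = hit
... | no miss = contradiction (injective⇒≤ h′-injective) 1+n≰n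
  where
  k≢h : ∀ i → k ≢ h i
  k≢h i e = miss (i , sym e)

  h′ : Fin (suc n) → Fin n
  h′ i = punchOut (k≢h i)

  h′-injective : Injective _≡_ _≡_ h′
  h′-injective e = h-injective (punchOut-injective (k≢h _) (k≢h _) e)

n*a+b<n*c : ∀ n {a b c} → b < n → a < c → n * a + b < n * c
n*a+b<n*c n {a} {b} {c} b<n a<c = begin-strict
  n * a + b   <⟨ +-monoʳ-< (n * a) b<n ⟩
  n * a + n   ≡⟨ +-comm (n * a) n ⟩
  n + n * a   ≡⟨ *-suc n a ⟨
  n * suc a   ≤⟨ *-monoʳ-≤ n a<c ⟩
  n * c       ∎
  where open ≤-Reasoning

n*c≤n*a+b : ∀ n {a c} b → c ≤ a → n * c ≤ n * a + b
n*c≤n*a+b n b c≤a = ≤-trans (*-monoʳ-≤ n c≤a) (m≤m+n _ b)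

module Ranking {m} (key : Subset m → ℕ) (key-injective : Injective _≡_ _≡_ key) where

  keysBelow : ℕ → ℕ
  keysBelow t = count (λ y → key y <? t)

  rank : Subset m → ℕ
  rank x = keysBelow (key x)

  key<⇔rank<keysBelow : ∀ x t → key x < t ⇔ rank x < keysBelow t
  key<⇔rank<keysBelow x t = mk⇔
    (λ kx<t → count-mono-< (λ y → key y <? key x) (λ y → key y <? t)
      (λ y ky<kx → <-trans ky<kx kx<t) x kx<t (<-irrefl refl))
    (λ r<kbt → ≰⇒> (λ t≤kx → <⇒≱ r<kbt
      (count-mono (λ y → key y <? t) (λ y → key y <? key x) (λ y ky<t → <-≤-trans ky<t t≤kx))))

  ≤key⇔keysBelow≤rank : ∀ x t → t ≤ key x ⇔ keysBelow t ≤ rank x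
  ≤key⇔keysBelow≤rank x t = mk⇔
    (λ t≤kx → ≮⇒≥ (λ r<kbt → ≤⇒≯ t≤kx (from r<kbt)))
    (λ kbt≤r → ≮⇒≥ (λ kx<t → ≤⇒≯ kbt≤r (to kx<t)))
    where open Equivalence (key<⇔rank<keysBelow x t)

  rank-mono-< : ∀ {x y} → key x < key y → rank x < rank y
  rank-mono-< {x} {y} = Equivalence.to (key<⇔rank<keysBelow x (key y))

  rank-injective : Injective _≡_ _≡_ rank
  rank-injective {x} {y} e with <-cmp (key x) (key y)
  ... | tri< kx<ky _ _ = contradiction e (<⇒≢ (rank-mono-< kx<ky))
  ... | tri≈ _ kx≡ky _ = key-injective kx≡ky
  ... | tri> _ _ ky<kx = contradiction (sym e) (<⇒≢ (rank-mono-< ky<kx))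

  rank<2^m : ∀ x → rank x < 2 ^ m
  rank<2^m x = subst (rank x <_) (count-U m)
    (count-mono-< (λ y → key y <? key x) U? (λ _ _ → tt) x tt (<-irrefl refl))

  label : Subset m → Fin (2 ^ m)
  label x = fromℕ< (rank<2^m x)

  toℕ-label : ∀ x → toℕ (label x) ≡ rank x
  toℕ-label x = toℕ-fromℕ< (rank<2^m x)

  label-injective : Injective _≡_ _≡_ label
  label-injective e = rank-injective (fromℕ<-injective _ _ _ _ e)

  -- decode shows there are at least 2 ^ m subsets, making label ∘ decode an injective endomap.
  label-strictlySurjective : StrictlySurjective _≡_ label
  label-strictlySurjective k with injective⇒strictlySurjective (label ∘ decode)
                                    (decode-injective ∘ label-injective) k
  ... | i , e = decode i , e

  ranking : Subset m ⤖ Fin (2 ^ m)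
  ranking = mk⤖ (label-injective , strictlySurjective⇒surjective label-strictlySurjective)

  label-mono-< : ∀ {x y} → key x < key y → toℕ (label x) < toℕ (label y)
  label-mono-< {x} {y} kx<ky rewrite toℕ-label x | toℕ-label y = rank-mono-< kx<ky

  ranking-interval : ∀ s t → LabelsFormInterval m ranking (λ x → s ≤ key x × key x < t)
  ranking-interval s t = keysBelow s , keysBelow t , λ x →
    subst (λ r → (s ≤ key x × key x < t) ⇔ (keysBelow s ≤ r × r < keysBelow t))
          (sym (toℕ-label x))
          (≤key⇔keysBelow≤rank x s ×-⇔ key<⇔rank<keysBelow x t)

module ConvexHull {n m} (f : Fin n → Subset m) where

  Above Below : Pred (Subset m) _
  Above x = ∃ λ a → f a ⊆ x
  Below x = ∃ λ c → x ⊆ f c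

  Above? : Decidable Above
  Above? x = any? (λ a → f a ⊆? x)

  Below? : Decidable Below
  Below? x = any? (λ c → x ⊆? f c)

  level : Subset m → ℕ
  level x = indicator (Above? x) + 2 * indicator (¬? (Below? x))

  level-mono : ∀ {x y} → x ⊆ y → level x ≤ level y
  level-mono {x} {y} x⊆y = +-mono-≤
    (indicator-mono (Above? x) (Above? y) λ (a , fa⊆x) → a , ⊆-trans fa⊆x x⊆y)
    (*-monoʳ-≤ 2 (indicator-mono (¬? (Below? x)) (¬? (Below? y))
      λ ¬below-x (c , y⊆fc) → ¬below-x (c , ⊆-trans x⊆y y⊆fc)))

  conv⇔level≡1 : ∀ x → conv f x ⇔ level x ≡ 1
  conv⇔level≡1 x = mk⇔ conv⇒level≡1 level≡1⇒conv
    where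
    level≡1⇒conv : level x ≡ 1 → conv f x
    level≡1⇒conv l≡1 with Above? x | Below? x
    ... | yes (a , fa⊆x) | yes (c , x⊆fc) = a , c , fa⊆x , x⊆fc
    ... | no _           | yes _          with () ← l≡1
    ... | yes _          | no _           with () ← l≡1
    ... | no _           | no _           with () ← l≡1

    conv⇒level≡1 : conv f x → level x ≡ 1
    conv⇒level≡1 (a , c , fa⊆x , x⊆fc) with Above? x | Below? x
    ... | yes _      | yes _       = refl
    ... | no ¬above  | _           = contradiction (a , λ {_} → fa⊆x) ¬above
    ... | yes _      | no ¬below   = contradiction (c , λ {_} → x⊆fc) ¬below

  key : Subset m → ℕ
  key x = 2 ^ m * level x + toℕ (encode x)

  key<⇔level< : ∀ x t → key x < 2 ^ m * t ⇔ level x < t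
  key<⇔level< x t = mk⇔
    (λ k<t → ≰⇒> (λ t≤l → <⇒≱ k<t (n*c≤n*a+b (2 ^ m) _ t≤l)))
    (n*a+b<n*c (2 ^ m) (toℕ<n (encode x)))

  level<⇒key< : ∀ {x y} → level x < level y → key x < key y
  level<⇒key< {x} {y} lx<ly =
    <-≤-trans (Equivalence.from (key<⇔level< x (level y)) lx<ly) (m≤m+n _ _)

  key-injective : Injective _≡_ _≡_ key
  key-injective {x} {y} e with <-cmp (level x) (level y)
  ... | tri< lx<ly _ _ = contradiction e (<⇒≢ (level<⇒key< lx<ly))
  ... | tri> _ _ ly<lx = contradiction (sym e) (<⇒≢ (level<⇒key< ly<lx))
  ... | tri≈ _ lx≡ly _ rewrite lx≡ly =
    encode-injective (toℕ-injective (+-cancelˡ-≡ (2 ^ m * level y) _ _ e))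

  key-mono-⊂ : ∀ {x y} → x ⊂ y → key x < key y
  key-mono-⊂ x⊂y = +-mono-≤-< (*-monoʳ-≤ (2 ^ m) (level-mono (proj₁ x⊂y))) (encode-mono-⊂ x⊂y)

  level≡1⇔key-range : ∀ x → level x ≡ 1 ⇔ (2 ^ m * 1 ≤ key x × key x < 2 ^ m * 2)
  level≡1⇔key-range x = mk⇔
    (λ l≡1 → ≮⇒≥ (<-irrefl l≡1 ∘ to (key<⇔level< x 1)) ,
             from (key<⇔level< x 2) (≤-reflexive (cong suc l≡1)))
    (λ (N≤k , k<2N) → ≤-antisym (s≤s⁻¹ (to (key<⇔level< x 2) k<2N))
                                (≮⇒≥ (≤⇒≯ N≤k ∘ from (key<⇔level< x 1))))
    where open Equivalence

  open Ranking key key-injective public using (ranking; label-mono-<; ranking-interval)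

  ranking-isLinear : IsLinearLabeling m ranking
  ranking-isLinear x⊂y = label-mono-< (key-mono-⊂ x⊂y)

  hull-interval : LabelsFormInterval m ranking (conv f)
  hull-interval with lo , hi , interval ← ranking-interval (2 ^ m * 1) (2 ^ m * 2) =
    lo , hi , λ x → interval x ⇔-∘ (level≡1⇔key-range x ⇔-∘ conv⇔level≡1 x)

lemma2 : (P : FinPoset) (m : ℕ) (f : Fin (size P) → B m) → IsEmbedding P m f →
    Σ (B m ⤖ Fin (2 ^ m)) λ L → IsLinearLabeling m L × LabelsFormInterval m L (conv f)
lemma2 P m f _ = ranking , ranking-isLinear , hull-interval
  where open ConvexHull f
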